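{- Let $G$ be a connected undirected simple graph and $f:V\to[n]$ any valuation of $G$. Then in the Markov chain of possibilities of $G$ there is a directed path from $f$ to some constant valuation $f_{con}$.
   Context: Let $G=(V,E)$ be a finite simple undirected graph with $n=|V|$ vertices and $[n]=\{1,\dots,n\}$. A valuation is a function $f:V\to[n]$; it is constant if it takes the same value at every vertex. The asynchronous maximum model: given the current valuation $f_t$, choose $v'\in V$ uniformly at random; set $f_{t+1}(v')=\max\{f_t(u): u\neq v' \text{ adjacent to } v'\}$ (unchanged if $v'$ has no neighbour), and $f_{t+1}(v)=f_t(v)$ for $v\neq v'$. The Markov chain of possibilities is the directed graph (loops allowed) whose vertices are all valuations $V\to[n]$, with an edge $f\to g$ whenever the one-round transition probability from $f$ to $g$ is positive. -}

module Defs where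

open import Data.Nat using (ℕ)
open import Data.Bool using (Bool; true; false; if_then_else_)
open import Data.Fin using (Fin; _≟_)
open import Data.Fin using (toℕ)
open import Data.Nat using (_≤ᵇ_)
open import Data.List using (List; foldr)
open import Data.List.Base using (allFin)
open import Data.Maybe using (Maybe; just; nothing)
open import Data.Product using (∃)
open import Relation.Nullary.Decidable using (does)
open import Relation.Binary.PropositionalEquality using (_≡_; _≢_)
open import Relation.Binary.Construct.Closure.ReflexiveTransitive using (Star)

record SimpleGraph (n : ℕ) : Set where
  field
    adj       : Fin n → Fin n → Bool
    symmetric : ∀ u v → adj u v ≡ adj v u
    loopless  : ∀ v → adj v v ≡ false

open SimpleGraph public

Adj : ∀ {n} → SimpleGraph n → Fin n → Fin n → Set
Adj G u v = adj G u v ≡ true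

Connected : ∀ {n} → SimpleGraph n → Set
Connected {n} G = ∀ (u w : Fin n) → Star (Adj G) u w

-- A valuation V → [n]; [n] = {1,…,n} is represented by Fin n (value i+1 ↦ i),
-- which preserves the order, hence maxima.
Valuation : ℕ → Set
Valuation n = Fin n → Fin n

_⊔ᶠ_ : ∀ {n} → Fin n → Fin n → Fin n
x ⊔ᶠ y = if toℕ x ≤ᵇ toℕ y then y else x

maxMaybe : ∀ {n} → Maybe (Fin n) → Fin n → Maybe (Fin n)
maxMaybe nothing  x = just x
maxMaybe (just y) x = just (y ⊔ᶠ x)

neighbourMax : ∀ {n} → SimpleGraph n → Valuation n → Fin n → Maybe (Fin n)
neighbourMax {n} G f v' =
  foldr (λ u acc → if adj G v' u then maxMaybe acc (f u) else acc) nothing (allFin n)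

updatedValue : ∀ {n} → SimpleGraph n → Valuation n → Fin n → Fin n
updatedValue G f v' with neighbourMax G f v'
... | just m  = m
... | nothing = f v'

update : ∀ {n} → SimpleGraph n → Valuation n → Fin n → Valuation n
update G f v' v = if does (v ≟ v') then updatedValue G f v' else f v

-- Edge f → g of the Markov chain of possibilities: the transition probability
-- is positive iff some vertex v' (chosen with probability 1/n > 0) produces g
-- (valuations compared pointwise).
Step : ∀ {n} → SimpleGraph n → Valuation n → Valuation n → Set
Step {n} G f g = ∃ λ (v' : Fin n) → ∀ v → update G f v' v ≡ g v

Path : ∀ {n} → SimpleGraph n → Valuation n → Valuation n → Set
Path G = Star (Step G)

IsConstant : ∀ {n} → Valuation n → Set
IsConstant {n} g = ∀ (u v : Fin n) → g u ≡ g v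

-- Let M be the largest value of f, attained at w. Updating a vertex never creates a value
-- above M, and updating a neighbour of a vertex holding M sets it to M while leaving every
-- other vertex untouched. So, walking from w to any vertex v and updating the vertices of
-- the walk in order, M is carried to v without losing it anywhere; doing this for every v
-- in turn ends at the constant valuation M.
module Submission where

open import Defs
open import Data.Nat using (ℕ; zero; suc; _≤ᵇ_)
open import Data.Nat.Properties using (≤ᵇ⇒≤; ≤⇒≤ᵇ)
open import Data.Product using (∃; _×_; _,_)
open import Data.Bool using (true; false; if_then_else_; T)
open import Data.Fin using (Fin; toℕ; _≤_; _≟_) renaming (zero to fzero)
open import Data.Fin.Properties using (≤-antisym)
open import Data.List using ([]; _∷_; foldr)
open import Data.List.Base using (allFin)
open import Data.List.Relation.Unary.All as All using (All; []; _∷_)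
open import Data.List.Relation.Unary.Any using (here; there)
open import Data.List.Membership.Propositional using (_∈_)
open import Data.List.Membership.Propositional.Properties using (∈-allFin)
open import Data.List.Extrema.Nat using (f[xs]≤f[argmax])
open import Data.Maybe using (Maybe; just; nothing)
import Data.Maybe.Relation.Unary.All as Maybe
open import Data.Unit using (tt)
open import Data.Empty using (⊥-elim)
open import Function using (_∘_; id)
open import Relation.Nullary using (yes; no)
open import Relation.Unary using (Pred; _⊆_)
open import Relation.Binary.PropositionalEquality using (_≡_; refl; sym; trans; cong; subst)
open import Relation.Binary.Construct.Closure.ReflexiveTransitive using (Star; ε; _◅_; _◅◅_)

⊔ᶠ-lub : ∀ {n} {x y z : Fin n} → x ≤ z → y ≤ z → x ⊔ᶠ y ≤ z
⊔ᶠ-lub {x = x} {y} x≤z y≤z with toℕ x ≤ᵇ toℕ y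
... | true  = y≤z
... | false = x≤z

x≤y⇒x⊔ᶠy≡y : ∀ {n} {x y : Fin n} → x ≤ y → x ⊔ᶠ y ≡ y
x≤y⇒x⊔ᶠy≡y {x = x} {y} x≤y with toℕ x ≤ᵇ toℕ y in eq
... | true  = refl
... | false = ⊥-elim (subst T eq (≤⇒≤ᵇ x≤y))

y≤x⇒x⊔ᶠy≡x : ∀ {n} {x y : Fin n} → y ≤ x → x ⊔ᶠ y ≡ x
y≤x⇒x⊔ᶠy≡x {x = x} {y} y≤x with toℕ x ≤ᵇ toℕ y in eq
... | true  = ≤-antisym y≤x (≤ᵇ⇒≤ (toℕ x) (toℕ y) (subst T (sym eq) tt))
... | false = refl

module Update {n : ℕ} (G : SimpleGraph n) where

  update-self : ∀ g v → update G g v v ≡ updatedValue G g v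
  update-self g v with v ≟ v
  ... | yes _  = refl
  ... | no v≢v = ⊥-elim (v≢v refl)

  module _ (g : Valuation n) (v : Fin n) (M : Fin n) (g≤M : ∀ u → g u ≤ M) where

    -- neighbourMax G g v is, definitionally, foldr absorb nothing (allFin n).
    absorb : Fin n → Maybe (Fin n) → Maybe (Fin n)
    absorb u acc = if adj G v u then maxMaybe acc (g u) else acc

    absorb-bounded : ∀ u {acc} → Maybe.All (_≤ M) acc → Maybe.All (_≤ M) (absorb u acc)
    absorb-bounded u acc≤M with adj G v u | acc≤M
    ... | false | _              = acc≤M
    ... | true  | Maybe.nothing  = Maybe.just (g≤M u)
    ... | true  | Maybe.just m≤M = Maybe.just (⊔ᶠ-lub m≤M (g≤M u))

    absorb-keeps-max : ∀ u → absorb u (just M) ≡ just M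
    absorb-keeps-max u with adj G v u
    ... | false = refl
    ... | true  = cong just (y≤x⇒x⊔ᶠy≡x (g≤M u))

    absorb-reaches-max : ∀ {a acc} → Adj G v a → g a ≡ M → Maybe.All (_≤ M) acc →
                         absorb a acc ≡ just M
    absorb-reaches-max {a} va ga≡M acc≤M with adj G v a | acc≤M
    ... | true | Maybe.nothing      = cong just ga≡M
    ... | true | Maybe.just {m} m≤M = cong just (trans (cong (m ⊔ᶠ_) ga≡M) (x≤y⇒x⊔ᶠy≡y m≤M))

    fold-bounded : ∀ us → Maybe.All (_≤ M) (foldr absorb nothing us)
    fold-bounded []       = Maybe.nothing
    fold-bounded (u ∷ us) = absorb-bounded u (fold-bounded us)

    fold-reaches-max : ∀ {a us} → Adj G v a → g a ≡ M → a ∈ us → foldr absorb nothing us ≡ just M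
    fold-reaches-max {us = u ∷ us} va ga≡M (here refl) = absorb-reaches-max va ga≡M (fold-bounded us)
    fold-reaches-max {us = u ∷ us} va ga≡M (there a∈us)
      rewrite fold-reaches-max va ga≡M a∈us = absorb-keeps-max u

    updatedValue-bounded : updatedValue G g v ≤ M
    updatedValue-bounded with neighbourMax G g v | fold-bounded (allFin n)
    ... | just m  | Maybe.just m≤M = m≤M
    ... | nothing | _              = g≤M v

    updatedValue-reaches-max : ∀ {a} → Adj G v a → g a ≡ M → updatedValue G g v ≡ M
    updatedValue-reaches-max {a} va ga≡M
      with neighbourMax G g v | fold-reaches-max va ga≡M (∈-allFin a)
    ... | just _ | refl = refl

module Saturation {n : ℕ} (G : SimpleGraph n) (M : Fin n) where

  open Update G

  Bounded : Valuation n → Set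
  Bounded g = ∀ u → g u ≤ M

  AtMax : Valuation n → Pred (Fin n) _
  AtMax g u = g u ≡ M

  ReachableKeepingMax : Valuation n → (Valuation n → Set) → Set
  ReachableKeepingMax g P = ∃ λ g' → Path G g g' × AtMax g ⊆ AtMax g' × P g'

  update-bounded : ∀ {g} v → Bounded g → Bounded (update G g v)
  update-bounded {g} v g≤M u with u ≟ v
  ... | yes _ = updatedValue-bounded g v M g≤M
  ... | no  _ = g≤M u

  path-bounded : ∀ {g g'} → Path G g g' → Bounded g → Bounded g'
  path-bounded ε                    g≤M = g≤M
  path-bounded ((v , updated≡) ◅ p) g≤M =
    path-bounded p (λ u → subst (_≤ M) (updated≡ u) (update-bounded v g≤M u))

  update-keeps-max : ∀ {g} v → updatedValue G g v ≡ M → AtMax g ⊆ AtMax (update G g v)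
  update-keeps-max {g} v gv≡M {u} gu≡M with u ≟ v
  ... | yes _ = gv≡M
  ... | no  _ = gu≡M

  reach-neighbour : ∀ {g a c} → Bounded g → Adj G a c → AtMax g a →
                    ReachableKeepingMax g (λ g' → AtMax g' c)
  reach-neighbour {g} {a} {c} g≤M ac ga≡M =
    update G g c , (c , λ _ → refl) ◅ ε , update-keeps-max c gc≡M , trans (update-self g c) gc≡M
    where
      gc≡M : updatedValue G g c ≡ M
      gc≡M = updatedValue-reaches-max g c M g≤M (trans (symmetric G c a) ac) ga≡M

  spread : ∀ {g a v} → Bounded g → Star (Adj G) a v → AtMax g a →
           ReachableKeepingMax g (λ g' → AtMax g' v)
  spread {g} g≤M ε ga≡M = g , ε , id , ga≡M
  spread g≤M (ac ◅ walk) ga≡M with reach-neighbour g≤M ac ga≡M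
  ... | g₁ , p₁ , keeps₁ , g₁c≡M with spread (path-bounded p₁ g≤M) walk g₁c≡M
  ... | g₂ , p₂ , keeps₂ , g₂v≡M = g₂ , p₁ ◅◅ p₂ , keeps₂ ∘ keeps₁ , g₂v≡M

  saturate : Connected G → ∀ {g w} → Bounded g → AtMax g w →
             ∀ vs → ReachableKeepingMax g (λ g' → All (AtMax g') vs)
  saturate conn {g} g≤M gw≡M [] = g , ε , id , []
  saturate conn {g} {w} g≤M gw≡M (v ∷ vs) with spread g≤M (conn w v) gw≡M
  ... | g₁ , p₁ , keeps₁ , g₁v≡M
    with saturate conn (path-bounded p₁ g≤M) (keeps₁ gw≡M) vs
  ... | g₂ , p₂ , keeps₂ , all₂ = g₂ , p₁ ◅◅ p₂ , keeps₂ ∘ keeps₁ , keeps₂ g₁v≡M ∷ all₂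

maximum-attained : ∀ {k m} (f : Fin (suc k) → Fin m) → ∃ λ w → ∀ u → f u ≤ f w
maximum-attained f =
  _ , λ u → All.lookup (f[xs]≤f[argmax] {f = toℕ ∘ f} fzero (allFin _)) (∈-allFin u)

mainTheorem6 : (n : ℕ) (G : SimpleGraph n) → Connected G → (f : Valuation n) →
    ∃ λ (fcon : Valuation n) → IsConstant fcon × Path G f fcon
mainTheorem6 zero    G conn f = f , (λ ()) , ε
mainTheorem6 (suc k) G conn f with maximum-attained f
... | w , f≤fw with Saturation.saturate G (f w) conn f≤fw refl (allFin (suc k))
... | g , path , _ , allAtMax = g , (λ u v → trans (atMax u) (sym (atMax v))) , path
  where
    atMax : ∀ u → g u ≡ f w
    atMax u = All.lookup allAtMax (∈-allFin u)
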